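{- Let $k\ge1$, fix monomials $f_{i,\sigma,\tau}(q)\in\mathbb{Z}[q]$ for $1\le i\le k$, $\sigma\ge1$, $\tau\ge0$, and use the weighted polynomials defined in the context. Then for every $n\ge1$, $$F_n^k(\mathbf z;q)=F_n^{k-1}(\mathbf z;q)+\sum_{j=0}^{n-k}z_k\,f_{k,j+1,n-k-j}(q)\,F_j^{k-1}(\mathbf z\mathbf s^+_{n-j};q)\,F_{n-k-j}^k(\mathbf z\mathbf s^-_{k+j};q).$$
   Context: Cells of an $n\times1$ board are numbered $1,\dots,n$. For $K\ge0$, a tiling of the board by tiles of length at most $K$ is a sequence of tiles of lengths $\ell_1,\dots,\ell_r\in\{1,\dots,K\}$ with $\ell_1+\cdots+\ell_r=n$; the $j$-th tile starts at cell $\sigma_j=1+\ell_1+\cdots+\ell_{j-1}$ and is followed by $\tau_j=n-(\sigma_j+\ell_j-1)$ cells. Let $\mathbf z=(z_1,\dots,z_k)$ be indeterminates. A tile of length $i$ that begins in cell $\sigma$ and is followed by $\tau$ cells has weight $z_i f_{i,\sigma,\tau}(q)$, and the weight of a tiling is the product of the weights of its tiles. For $K\in\{k-1,k\}$ and integers $a,b\ge0$ define $$F_n^K[a,b]=\sum \prod_{j=1}^r z_{\ell_j}\,f_{\ell_j,\,a+\sigma_j,\,b+\tau_j}(q),$$ the sum over all tilings of the $n\times1$ board by tiles of length at most $K$ (the weighted count of tilings of an $n\times 1$ board with an untiled $a\times1$ board appended before it and an untiled $b\times1$ board appended after it). By convention $F_0^K[a,b]=1$ (empty tiling) and $F_n^K[a,b]=0$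 for $n<0$ (and for $K=0$, $F_n^0[a,b]=0$ for $n>0$). Notation: $F_n^K(\mathbf z;q)=F_n^K[0,0]$, $F_n^K(\mathbf z\mathbf s^+_m;q)=F_n^K[0,m]$, $F_n^K(\mathbf z\mathbf s^-_m;q)=F_n^K[m,0]$. -}

module Defs where

open import Level using (Level)
open import Data.Nat using (ℕ; zero; suc; _+_; _∸_; _≤?_)
open import Data.List using (List; []; _∷_; [_]; map; concatMap; filter; upTo; foldr)
open import Algebra.Bundles using (CommutativeRing)

-- Tilings of an n×1 board by tiles of length at most K, as the list of
-- tile lengths (ℓ₁, …, ℓ_r) with each ℓⱼ ∈ {1,…,K} and ℓ₁+⋯+ℓ_r = n.
-- 'tilingsFuel K fuel m' enumerates all compositions of m with parts in
-- {1,…,K}; the fuel is only a termination device (fuel = m suffices).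
tilingsFuel : ℕ → ℕ → ℕ → List (List ℕ)
tilingsFuel K zero       zero    = [ [] ]
tilingsFuel K zero       (suc m) = []
tilingsFuel K (suc fuel) zero    = [ [] ]
tilingsFuel K (suc fuel) (suc m) =
  concatMap (λ ℓ → map (ℓ ∷_) (tilingsFuel K fuel (suc m ∸ ℓ)))
            (filter (λ ℓ → ℓ ≤? suc m) (map suc (upTo K)))

tilings : ℕ → ℕ → List (List ℕ)
tilings K n = tilingsFuel K n n

module Weighted {c ℓ′ : Level} (R : CommutativeRing c ℓ′) where
  open CommutativeRing R public renaming (_+_ to _+ᴿ_; _*_ to _*ᴿ_)

  -- weight of a tiling (tile lengths ls) of a board of m remaining cells
  -- whose first remaining cell is cell a+1 of the extended board and which
  -- is followed by b further (untiled) cells.  A tile of length i starting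
  -- at cell σ, followed by τ cells, has weight z i * f i σ τ.
  weightFrom : (z : ℕ → Carrier) (f : ℕ → ℕ → ℕ → Carrier) →
               ℕ → ℕ → ℕ → List ℕ → Carrier
  weightFrom z f a b m []       = 1#
  weightFrom z f a b m (i ∷ ls) =
    (z i *ᴿ f i (a + 1) (b + (m ∸ i))) *ᴿ weightFrom z f (a + i) b (m ∸ i) ls

  sumList : List Carrier → Carrier
  sumList = foldr _+ᴿ_ 0#

  F : (z : ℕ → Carrier) (f : ℕ → ℕ → ℕ → Carrier) →
      (K n a b : ℕ) → Carrier
  F z f K n a b = sumList (map (weightFrom z f a b n) (tilings K n))

  sumRange : ℕ → (ℕ → Carrier) → Carrier
  sumRange N g = sumList (map g (upTo N))

module Submission where

-- Write k = κ + 1.  A tiling with tiles of length ≤ k either uses no tile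
-- of length k (these are counted by F^κ), or has a first tile of length k,
-- starting in cell j + 1, preceded by a κ-tiling of j cells and followed
-- by an arbitrary k-tiling; the sum G over j collects these.  Since the
-- weights depend on the position of a tile inside the whole board, the
-- identity is proved for boards with a untiled cells in front and b behind:
--
--   F^k_m[a,b] = F^κ_m[a,b] + G_m[a,b]                   (decomposition)
--
-- The only structural fact about tilings that is used is the first-tile
-- recurrence F^K_{m+1}[a,b] = Σ_{l<K} [l ≤ m] w_l F^K_{m-l}[a+l+1,b]
-- (module FirstTile).  F^k and F^κ + G satisfy the same recurrence: for
-- F^κ this is again the first-tile recurrence, and for G it follows by
-- expanding the first tile of the κ-tiling in each summand and exchanging
-- the two sums (module Decomposition, lemma G-recurrence).

open import Defs
open import Level using (Level)
open import Data.Nat using (ℕ; zero; suc; _+_; _∸_; _≤_; _<_; _≤?_; z≤n; s≤s)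
import Data.Nat.Properties as ℕP
open import Data.Nat.Induction using (<-rec)
open import Data.Nat.Tactic.RingSolver using (solve-∀)
open import Data.List using (List; []; _∷_; map; concatMap; concat; filter; upTo; applyUpTo; _++_)
open import Relation.Nullary using (Dec; yes; no; ¬_)
open import Relation.Unary using (Pred; Decidable)
open import Data.Empty using (⊥-elim)
import Relation.Binary.PropositionalEquality as P
open import Algebra.Bundles using (CommutativeRing)
import Algebra.Properties.CommutativeSemigroup as CommSemigroupProperties

-- Cell bookkeeping: a tile placed after a first tile of length l + 1 sits,
-- relative to the board shifted by l + 1 cells, i cells further on.
module BoardArithmetic where
  open P using (_≡_; cong; trans; sym)

  shift-start : ∀ a l i → a + suc (suc (l + i)) ≡ (a + suc l) + suc i
  shift-start = solve-∀

  shift-prefix : ∀ a κ l i → a + (suc κ + suc (l + i)) ≡ (a + suc l) + (suc κ + i)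
  shift-prefix = solve-∀

  ∸-comm : ∀ m κ l → m ∸ κ ∸ l ≡ m ∸ l ∸ κ
  ∸-comm m κ l = trans (ℕP.∸-+-assoc m κ l)
    (trans (cong (m ∸_) (ℕP.+-comm κ l)) (sym (ℕP.∸-+-assoc m l κ)))

  shift-remaining : ∀ m κ l i → m ∸ κ ∸ suc (l + i) ≡ m ∸ l ∸ suc κ ∸ i
  shift-remaining m κ l i = trans (ℕP.∸-+-assoc m κ (suc (l + i)))
    (trans (cong (m ∸_) (reorder κ l i))
    (sym (trans (ℕP.∸-+-assoc (m ∸ l) (suc κ) i) (ℕP.∸-+-assoc m l (suc κ + i)))))
    where
    reorder : ∀ κ l i → κ + suc (l + i) ≡ l + (suc κ + i)
    reorder = solve-∀

  -- cells following the first tile: those after position l + i, plus i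
  shift-following : ∀ b m l i → l + i ≤ m → (b + (m ∸ (l + i))) + ((l + i) ∸ l) ≡ b + (m ∸ l)
  shift-following b m l i l+i≤m = trans (ℕP.+-assoc b _ _)
    (cong (b +_) (trans (cong ((m ∸ (l + i)) +_) (ℕP.m+n∸m≡n l i)) (rest m l i l+i≤m)))
    where
    rest : ∀ m l i → l + i ≤ m → (m ∸ (l + i)) + i ≡ m ∸ l
    rest m zero i p = ℕP.m∸n+n≡m p
    rest (suc m) (suc l) i (s≤s p) = rest m l i p

  <-∸⇒+< : ∀ x l i → i < x ∸ l → l + i < x
  <-∸⇒+< x zero i p = p
  <-∸⇒+< zero (suc l) i ()
  <-∸⇒+< (suc x) (suc l) i p = s≤s (<-∸⇒+< x l i p)

module Sums {c ℓ′ : Level} (R : CommutativeRing c ℓ′) where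
  open Weighted R
  open CommSemigroupProperties +-commutativeSemigroup using (interchange)
  open import Relation.Binary.Reasoning.Setoid setoid

  Σ< : ℕ → (ℕ → Carrier) → Carrier
  Σ< zero g = 0#
  Σ< (suc N) g = g 0 +ᴿ Σ< N (λ j → g (suc j))

  Σ-cong : ∀ N {g h : ℕ → Carrier} → (∀ i → i < N → g i ≈ h i) → Σ< N g ≈ Σ< N h
  Σ-cong zero eq = refl
  Σ-cong (suc N) eq = +-cong (eq 0 (s≤s z≤n)) (Σ-cong N (λ i i<N → eq (suc i) (s≤s i<N)))

  Σ-cong′ : ∀ N {g h : ℕ → Carrier} → (∀ i → g i ≈ h i) → Σ< N g ≈ Σ< N h
  Σ-cong′ N eq = Σ-cong N (λ i _ → eq i)

  Σ-bound : ∀ {N M} (g : ℕ → Carrier) → N P.≡ M → Σ< N g ≈ Σ< M g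
  Σ-bound g P.refl = refl

  Σ-zero : ∀ N (g : ℕ → Carrier) → (∀ i → i < N → g i ≈ 0#) → Σ< N g ≈ 0#
  Σ-zero N g eq = trans (Σ-cong N eq) (zeros N)
    where
    zeros : ∀ N → Σ< N (λ _ → 0#) ≈ 0#
    zeros zero = refl
    zeros (suc N) = trans (+-identityˡ _) (zeros N)

  Σ-+ : ∀ N (g h : ℕ → Carrier) → Σ< N (λ i → g i +ᴿ h i) ≈ Σ< N g +ᴿ Σ< N h
  Σ-+ zero g h = sym (+-identityˡ 0#)
  Σ-+ (suc N) g h = trans (+-cong refl (Σ-+ N _ _)) (interchange _ _ _ _)

  Σ-*ˡ : ∀ N (x : Carrier) (g : ℕ → Carrier) → x *ᴿ Σ< N g ≈ Σ< N (λ i → x *ᴿ g i)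
  Σ-*ˡ zero x g = zeroʳ x
  Σ-*ˡ (suc N) x g = trans (distribˡ x _ _) (+-cong refl (Σ-*ˡ N x _))

  Σ-*ʳ : ∀ N (x : Carrier) (g : ℕ → Carrier) → Σ< N g *ᴿ x ≈ Σ< N (λ i → g i *ᴿ x)
  Σ-*ʳ N x g = trans (*-comm _ x) (trans (Σ-*ˡ N x g) (Σ-cong′ N (λ i → *-comm x (g i))))

  Σ-snoc : ∀ N (g : ℕ → Carrier) → Σ< (suc N) g ≈ Σ< N g +ᴿ g N
  Σ-snoc zero g = trans (+-identityʳ _) (sym (+-identityˡ _))
  Σ-snoc (suc N) g = trans (+-cong refl (Σ-snoc N _)) (sym (+-assoc _ _ _))

  Σ-swap : ∀ N K (h : ℕ → ℕ → Carrier) →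
    Σ< N (λ j → Σ< K (h j)) ≈ Σ< K (λ l → Σ< N (λ j → h j l))
  Σ-swap zero K h = sym (Σ-zero K _ (λ _ _ → refl))
  Σ-swap (suc N) K h = trans (+-cong refl (Σ-swap N K _)) (sym (Σ-+ K _ _))

  infixr 8 [_]·_
  [_]·_ : ∀ {p} {Q : Set p} → Dec Q → Carrier → Carrier
  [ yes _ ]· x = x
  [ no _ ]· x = 0#

  bracket-yes : ∀ {p} {Q : Set p} (d : Dec Q) {x} → Q → [ d ]· x ≈ x
  bracket-yes (yes _) q = refl
  bracket-yes (no ¬q) q = ⊥-elim (¬q q)

  bracket-no : ∀ {p} {Q : Set p} (d : Dec Q) {x} → ¬ Q → [ d ]· x ≈ 0#
  bracket-no (yes q) ¬q = ⊥-elim (¬q q)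
  bracket-no (no _) ¬q = refl

  bracket-cong : ∀ {p} {Q : Set p} (d : Dec Q) {x y} → x ≈ y → [ d ]· x ≈ [ d ]· y
  bracket-cong (yes _) e = e
  bracket-cong (no _) e = refl

  bracket-0# : ∀ {p} {Q : Set p} (d : Dec Q) → [ d ]· 0# ≈ 0#
  bracket-0# (yes _) = refl
  bracket-0# (no _) = refl

  bracket-+ : ∀ {p} {Q : Set p} (d : Dec Q) x y → [ d ]· (x +ᴿ y) ≈ [ d ]· x +ᴿ [ d ]· y
  bracket-+ (yes _) x y = refl
  bracket-+ (no _) x y = sym (+-identityˡ 0#)

  bracket-*ˡ : ∀ {p} {Q : Set p} (d : Dec Q) x y → x *ᴿ [ d ]· y ≈ [ d ]· (x *ᴿ y)
  bracket-*ˡ (yes _) x y = refl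
  bracket-*ˡ (no _) x y = zeroʳ x

  bracket-*ʳ : ∀ {p} {Q : Set p} (d : Dec Q) x y → [ d ]· x *ᴿ y ≈ [ d ]· (x *ᴿ y)
  bracket-*ʳ (yes _) x y = refl
  bracket-*ʳ (no _) x y = zeroˡ y

  bracket-⇔ : ∀ {p q} {Q : Set p} {Q′ : Set q} (d : Dec Q) (d′ : Dec Q′) x →
    (Q → Q′) → (Q′ → Q) → [ d ]· x ≈ [ d′ ]· x
  bracket-⇔ (yes _) (yes _) x to from = refl
  bracket-⇔ (yes q) (no ¬q) x to from = ⊥-elim (¬q (to q))
  bracket-⇔ (no ¬q) (yes q) x to from = ⊥-elim (¬q (from q))
  bracket-⇔ (no _) (no _) x to from = refl

  Σ-from : ∀ l N (g : ℕ → Carrier) →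
    Σ< N (λ j → [ suc l ≤? suc j ]· g j) ≈ Σ< (N ∸ l) (λ i → g (l + i))
  Σ-from zero N g = Σ-cong′ N (λ j → bracket-yes (1 ≤? suc j) (s≤s z≤n))
  Σ-from (suc l) zero g = refl
  Σ-from (suc l) (suc N) g = begin
    [ suc (suc l) ≤? 1 ]· g 0 +ᴿ Σ< N (λ j → [ suc (suc l) ≤? suc (suc j) ]· g (suc j))
      ≈⟨ +-cong (bracket-no (suc (suc l) ≤? 1) {g 0} (λ { (s≤s ()) })) refl ⟩
    0# +ᴿ Σ< N (λ j → [ suc (suc l) ≤? suc (suc j) ]· g (suc j))
      ≈⟨ +-identityˡ _ ⟩
    Σ< N (λ j → [ suc (suc l) ≤? suc (suc j) ]· g (suc j))
      ≈⟨ Σ-cong′ N (λ j → bracket-⇔ (suc (suc l) ≤? suc (suc j)) (suc l ≤? suc j) (g (suc j)) ℕP.≤-pred s≤s) ⟩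
    Σ< N (λ j → [ suc l ≤? suc j ]· g (suc j))
      ≈⟨ Σ-from l N (λ j → g (suc j)) ⟩
    Σ< (N ∸ l) (λ i → g (suc l + i)) ∎

  sum-++ : ∀ {A : Set} (h : A → Carrier) xs ys →
    sumList (map h (xs ++ ys)) ≈ sumList (map h xs) +ᴿ sumList (map h ys)
  sum-++ h [] ys = sym (+-identityˡ _)
  sum-++ h (x ∷ xs) ys = trans (+-cong refl (sum-++ h xs ys)) (sym (+-assoc _ _ _))

  sum-concatMap : ∀ {A B : Set} (h : B → Carrier) (g : A → List B) xs →
    sumList (map h (concatMap g xs)) ≈ sumList (map (λ x → sumList (map h (g x))) xs)
  sum-concatMap h g [] = refl
  sum-concatMap h g (x ∷ xs) =
    trans (sum-++ h (g x) (concat (map g xs))) (+-cong refl (sum-concatMap h g xs))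

  sum-filter : ∀ {A : Set} {p} {Q : Pred A p} (Q? : Decidable Q) (h : A → Carrier) xs →
    sumList (map h (filter Q? xs)) ≈ sumList (map (λ x → [ Q? x ]· h x) xs)
  sum-filter Q? h [] = refl
  sum-filter Q? h (x ∷ xs) with Q? x
  ... | yes _ = +-cong refl (sum-filter Q? h xs)
  ... | no _ = trans (sum-filter Q? h xs) (sym (+-identityˡ _))

  sum-map : ∀ {A B : Set} (h : B → Carrier) (g : A → B) xs →
    sumList (map h (map g xs)) ≈ sumList (map (λ x → h (g x)) xs)
  sum-map h g [] = refl
  sum-map h g (x ∷ xs) = +-cong refl (sum-map h g xs)

  sum-applyUpTo : ∀ (h : ℕ → Carrier) (g : ℕ → ℕ) N →
    sumList (map h (applyUpTo g N)) ≈ Σ< N (λ i → h (g i))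
  sum-applyUpTo h g zero = refl
  sum-applyUpTo h g (suc N) = +-cong refl (sum-applyUpTo h (λ i → g (suc i)) N)

  sum-*ˡ : ∀ {A : Set} (x : Carrier) (h : A → Carrier) xs →
    sumList (map (λ y → x *ᴿ h y) xs) ≈ x *ᴿ sumList (map h xs)
  sum-*ˡ x h [] = sym (zeroʳ x)
  sum-*ˡ x h (y ∷ ys) = trans (+-cong refl (sum-*ˡ x h ys)) (sym (distribˡ x _ _))

  sumRange≈Σ< : ∀ N (g : ℕ → Carrier) → sumRange N g ≈ Σ< N g
  sumRange≈Σ< N g = sum-applyUpTo g (λ i → i) N

module FirstTile {c ℓ′ : Level} (R : CommutativeRing c ℓ′) (z : ℕ → CommutativeRing.Carrier R)
  (f : ℕ → ℕ → ℕ → CommutativeRing.Carrier R) where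
  open Weighted R
  open Sums R
  open import Relation.Binary.Reasoning.Setoid setoid

  -- weight of a first tile of length l + 1 on a board of m + 1 cells
  -- preceded by a and followed by b untiled cells
  w : ℕ → ℕ → ℕ → ℕ → Carrier
  w a b m l = z (suc l) *ᴿ f (suc l) (a + 1) (b + (m ∸ l))

  Fuel : ℕ → ℕ → ℕ → ℕ → ℕ → Carrier
  Fuel K fuel m a b = sumList (map (weightFrom z f a b m) (tilingsFuel K fuel m))

  first-tile-fuel : ∀ K fuel m a b → Fuel K (suc fuel) (suc m) a b ≈
    Σ< K (λ l → [ suc l ≤? suc m ]· (w a b m l *ᴿ Fuel K fuel (m ∸ l) (a + suc l) b))
  first-tile-fuel K fuel m a b = begin
    Fuel K (suc fuel) (suc m) a b
      ≈⟨ sum-concatMap W extend (filter (_≤? suc m) (map suc (upTo K))) ⟩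
    sumList (map (λ l → sumList (map W (extend l))) (filter (_≤? suc m) (map suc (upTo K))))
      ≈⟨ sum-filter (_≤? suc m) (λ l → sumList (map W (extend l))) (map suc (upTo K)) ⟩
    sumList (map (λ l → [ l ≤? suc m ]· sumList (map W (extend l))) (map suc (upTo K)))
      ≈⟨ sum-map (λ l → [ l ≤? suc m ]· sumList (map W (extend l))) suc (upTo K) ⟩
    sumList (map (λ l → [ suc l ≤? suc m ]· sumList (map W (extend (suc l)))) (upTo K))
      ≈⟨ sum-applyUpTo (λ l → [ suc l ≤? suc m ]· sumList (map W (extend (suc l)))) (λ i → i) K ⟩
    Σ< K (λ l → [ suc l ≤? suc m ]· sumList (map W (extend (suc l))))
      ≈⟨ Σ-cong′ K (λ l → bracket-cong (suc l ≤? suc m) (factor l)) ⟩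
    Σ< K (λ l → [ suc l ≤? suc m ]· (w a b m l *ᴿ Fuel K fuel (m ∸ l) (a + suc l) b)) ∎
    where
    W : List ℕ → Carrier
    W = weightFrom z f a b (suc m)
    extend : ℕ → List (List ℕ)
    extend l = map (l ∷_) (tilingsFuel K fuel (suc m ∸ l))
    factor : ∀ l → sumList (map W (extend (suc l))) ≈ w a b m l *ᴿ Fuel K fuel (m ∸ l) (a + suc l) b
    factor l = trans (sum-map W (suc l ∷_) (tilingsFuel K fuel (m ∸ l)))
                     (sum-*ˡ (w a b m l) (weightFrom z f (a + suc l) b (m ∸ l)) (tilingsFuel K fuel (m ∸ l)))

  fuel-irrelevant : ∀ K fuel fuel′ m a b → m ≤ fuel → m ≤ fuel′ → Fuel K fuel m a b ≈ Fuel K fuel′ m a b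
  fuel-irrelevant K zero zero zero a b _ _ = refl
  fuel-irrelevant K zero (suc fuel′) zero a b _ _ = refl
  fuel-irrelevant K (suc fuel) zero zero a b _ _ = refl
  fuel-irrelevant K (suc fuel) (suc fuel′) zero a b _ _ = refl
  fuel-irrelevant K (suc fuel) (suc fuel′) (suc m) a b (s≤s p) (s≤s q) =
    trans (first-tile-fuel K fuel m a b) (trans
      (Σ-cong′ K (λ l → bracket-cong (suc l ≤? suc m) (*-cong refl
        (fuel-irrelevant K fuel fuel′ (m ∸ l) _ b (ℕP.≤-trans (ℕP.m∸n≤m m l) p) (ℕP.≤-trans (ℕP.m∸n≤m m l) q)))))
      (sym (first-tile-fuel K fuel′ m a b)))

  first-tile : ∀ K m a b → F z f K (suc m) a b ≈
    Σ< K (λ l → [ suc l ≤? suc m ]· (w a b m l *ᴿ F z f K (m ∸ l) (a + suc l) b))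
  first-tile K m a b = trans (first-tile-fuel K m m a b)
    (Σ-cong′ K (λ l → bracket-cong (suc l ≤? suc m) (*-cong refl
        (fuel-irrelevant K m (m ∸ l) (m ∸ l) _ b (ℕP.m∸n≤m m l) ℕP.≤-refl))))

module Decomposition {c ℓ′ : Level} (R : CommutativeRing c ℓ′) (z : ℕ → CommutativeRing.Carrier R)
  (f : ℕ → ℕ → ℕ → CommutativeRing.Carrier R) (κ : ℕ) where
  open Weighted R
  open Sums R
  open FirstTile R z f
  open BoardArithmetic
  open CommSemigroupProperties *-commutativeSemigroup using (x∙yz≈y∙xz)
  open import Relation.Binary.Reasoning.Setoid setoid

  k : ℕ
  k = suc κ

  -- tilings whose first tile of length k starts in cell j + 1 (of m cells)
  term : ℕ → ℕ → ℕ → ℕ → Carrier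
  term a b m j = ((z k *ᴿ f k (a + suc j) (b + (m ∸ k ∸ j))) *ᴿ F z f κ j a (b + (m ∸ j)))
                 *ᴿ F z f k (m ∸ k ∸ j) (a + (k + j)) b

  G : ℕ → ℕ → ℕ → Carrier
  G m a b = Σ< (suc m ∸ k) (term a b m)

  -- summand of term (m+1) (j+1) after expanding the first tile (of length
  -- l + 1) of its κ-tiling
  piece : ℕ → ℕ → ℕ → ℕ → ℕ → Carrier
  piece a b m j l = ((z k *ᴿ f k (a + suc (suc j)) (b + (m ∸ κ ∸ suc j)))
                     *ᴿ (w a (b + (m ∸ j)) j l *ᴿ F z f κ (j ∸ l) (a + suc l) (b + (m ∸ j))))
                    *ᴿ F z f k (m ∸ κ ∸ suc j) (a + (k + suc j)) b

  term-first-tile : ∀ a b m j →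
    term a b (suc m) (suc j) ≈ Σ< κ (λ l → [ suc l ≤? suc j ]· piece a b m j l)
  term-first-tile a b m j = begin
    (C *ᴿ F z f κ (suc j) a (b + (m ∸ j))) *ᴿ S
      ≈⟨ *-cong (*-cong refl (first-tile κ j a (b + (m ∸ j)))) refl ⟩
    (C *ᴿ Σ< κ (λ l → [ suc l ≤? suc j ]· V l)) *ᴿ S
      ≈⟨ *-cong (Σ-*ˡ κ C _) refl ⟩
    Σ< κ (λ l → C *ᴿ [ suc l ≤? suc j ]· V l) *ᴿ S
      ≈⟨ Σ-*ʳ κ S _ ⟩
    Σ< κ (λ l → (C *ᴿ [ suc l ≤? suc j ]· V l) *ᴿ S)
      ≈⟨ Σ-cong′ κ (λ l → trans (*-cong (bracket-*ˡ (suc l ≤? suc j) C (V l)) refl)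
                                (bracket-*ʳ (suc l ≤? suc j) (C *ᴿ V l) S)) ⟩
    Σ< κ (λ l → [ suc l ≤? suc j ]· piece a b m j l) ∎
    where
    C = z k *ᴿ f k (a + suc (suc j)) (b + (m ∸ κ ∸ suc j))
    S = F z f k (m ∸ κ ∸ suc j) (a + (k + suc j)) b
    V : ℕ → Carrier
    V l = w a (b + (m ∸ j)) j l *ᴿ F z f κ (j ∸ l) (a + suc l) (b + (m ∸ j))

  piece-shift : ∀ a b m l i → l + i ≤ m →
    piece a b m (l + i) l ≈ w a b m l *ᴿ term (a + suc l) b (m ∸ l) i
  piece-shift a b m l i l+i≤m = trans (*-cong (x∙yz≈y∙xz _ _ _) refl) (trans (*-assoc _ _ _)
    (*-cong (reflexive (P.cong (λ x → z (suc l) *ᴿ f (suc l) (a + 1) x) (shift-following b m l i l+i≤m)))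
      (*-cong (*-cong (reflexive (P.cong₂ (λ x y → z k *ᴿ f k x (b + y)) (shift-start a l i) (shift-remaining m κ l i)))
                      (reflexive (P.cong₂ (λ x y → F z f κ x (a + suc l) (b + y))
                                          (ℕP.m+n∸m≡n l i) (P.sym (ℕP.∸-+-assoc m l i)))))
              (reflexive (P.cong₂ (λ x y → F z f k x y b) (shift-remaining m κ l i) (shift-prefix a κ l i))))))

  pieces-reassemble : ∀ a b m l →
    Σ< (m ∸ κ ∸ l) (λ i → piece a b m (l + i) l) ≈ [ suc l ≤? suc m ]· (w a b m l *ᴿ G (m ∸ l) (a + suc l) b)
  pieces-reassemble a b m l with l ℕP.≤? m
  ... | no l≰m = trans (Σ-bound _ (ℕP.m≤n⇒m∸n≡0 (ℕP.≤-trans (ℕP.m∸n≤m m κ) (ℕP.<⇒≤ (ℕP.≰⇒> l≰m)))))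
                       (sym (bracket-no (suc l ≤? suc m) (λ q → l≰m (ℕP.≤-pred q))))
  ... | yes l≤m = begin
    Σ< (m ∸ κ ∸ l) (λ i → piece a b m (l + i) l)
      ≈⟨ Σ-bound _ (∸-comm m κ l) ⟩
    Σ< (m ∸ l ∸ κ) (λ i → piece a b m (l + i) l)
      ≈⟨ Σ-cong (m ∸ l ∸ κ) (λ i i< → piece-shift a b m l i (bounded i i<)) ⟩
    Σ< (m ∸ l ∸ κ) (λ i → w a b m l *ᴿ term (a + suc l) b (m ∸ l) i)
      ≈⟨ sym (Σ-*ˡ (m ∸ l ∸ κ) _ _) ⟩
    w a b m l *ᴿ G (m ∸ l) (a + suc l) b
      ≈⟨ sym (bracket-yes (suc l ≤? suc m) (s≤s l≤m)) ⟩
    [ suc l ≤? suc m ]· (w a b m l *ᴿ G (m ∸ l) (a + suc l) b) ∎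
    where
    bounded : ∀ i → i < m ∸ l ∸ κ → l + i ≤ m
    bounded i i< = ℕP.<⇒≤ (ℕP.<-≤-trans (<-∸⇒+< (m ∸ κ) l i (P.subst (i <_) (P.sym (∸-comm m κ l)) i<))
                                        (ℕP.m∸n≤m m κ))

  k-tile-first : ℕ → ℕ → ℕ → Carrier
  k-tile-first a b m = [ suc κ ≤? suc m ]· (w a b m κ *ᴿ F z f k (m ∸ κ) (a + suc κ) b)

  -- G follows the first-tile recurrence, except that a first tile of
  -- length k is followed by an arbitrary k-tiling
  G-recurrence : ∀ a b m → G (suc m) a b ≈
    Σ< κ (λ l → [ suc l ≤? suc m ]· (w a b m l *ᴿ G (m ∸ l) (a + suc l) b)) +ᴿ k-tile-first a b m
  G-recurrence a b m with κ ℕP.≤? m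
  ... | no κ≰m = trans (Σ-bound _ (ℕP.m≤n⇒m∸n≡0 (ℕP.≰⇒> κ≰m))) (sym (trans
          (+-cong (Σ-zero κ _ (λ l _ → short l))
                  (bracket-no (suc κ ≤? suc m) (λ q → κ≰m (ℕP.≤-pred q))))
          (+-identityˡ 0#)))
    where
    -- the boards m - l are shorter than k, so G vanishes on them
    short : ∀ l → [ suc l ≤? suc m ]· (w a b m l *ᴿ G (m ∸ l) (a + suc l) b) ≈ 0#
    short l = trans (bracket-cong (suc l ≤? suc m)
                      (trans (*-cong refl (Σ-bound _ (ℕP.m≤n⇒m∸n≡0
                                (ℕP.≤-trans (ℕP.m∸n≤m m l) (ℕP.<⇒≤ (ℕP.≰⇒> κ≰m))))))
                             (zeroʳ _)))
                    (bracket-0# (suc l ≤? suc m))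
  ... | yes κ≤m = begin
    G (suc m) a b
      ≈⟨ Σ-bound (term a b (suc m)) (ℕP.+-∸-assoc 1 κ≤m) ⟩
    term a b (suc m) 0 +ᴿ Σ< (m ∸ κ) (λ j → term a b (suc m) (suc j))
      ≈⟨ +-cong first-term (Σ-cong′ (m ∸ κ) (term-first-tile a b m)) ⟩
    k-tile-first a b m +ᴿ Σ< (m ∸ κ) (λ j → Σ< κ (λ l → [ suc l ≤? suc j ]· piece a b m j l))
      ≈⟨ +-cong refl (Σ-swap (m ∸ κ) κ (λ j l → [ suc l ≤? suc j ]· piece a b m j l)) ⟩
    k-tile-first a b m +ᴿ Σ< κ (λ l → Σ< (m ∸ κ) (λ j → [ suc l ≤? suc j ]· piece a b m j l))
      ≈⟨ +-cong refl (Σ-cong′ κ (λ l → trans (Σ-from l (m ∸ κ) (λ j → piece a b m j l))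
                                              (pieces-reassemble a b m l))) ⟩
    k-tile-first a b m +ᴿ Σ< κ (λ l → [ suc l ≤? suc m ]· (w a b m l *ᴿ G (m ∸ l) (a + suc l) b))
      ≈⟨ +-comm _ _ ⟩
    Σ< κ (λ l → [ suc l ≤? suc m ]· (w a b m l *ᴿ G (m ∸ l) (a + suc l) b)) +ᴿ k-tile-first a b m ∎
    where
    -- j = 0: the k-tile comes first, and F^κ_0 = 1
    first-term : term a b (suc m) 0 ≈ k-tile-first a b m
    first-term = trans (*-cong (trans (*-cong refl (+-identityʳ 1#)) (*-identityʳ _))
                               (reflexive (P.cong (λ x → F z f k (m ∸ κ) (a + x) b) (ℕP.+-identityʳ k))))
                       (sym (bracket-yes (suc κ ≤? suc m) (s≤s κ≤m)))

  decomposition : ∀ m a b → F z f k m a b ≈ F z f κ m a b +ᴿ G m a b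
  decomposition = <-rec (λ m → ∀ a b → F z f k m a b ≈ F z f κ m a b +ᴿ G m a b) step
    where
    step : ∀ m → (∀ {m′} → m′ < m → ∀ a b → F z f k m′ a b ≈ F z f κ m′ a b +ᴿ G m′ a b) →
           ∀ a b → F z f k m a b ≈ F z f κ m a b +ᴿ G m a b
    step zero _ a b = sym (trans (+-cong refl (Σ-bound (term a b 0) (ℕP.0∸n≡0 κ))) (+-identityʳ _))
    step (suc m) ih a b = begin
      F z f k (suc m) a b           ≈⟨ first-tile k m a b ⟩
      Σ< (suc κ) φ                   ≈⟨ Σ-snoc κ φ ⟩
      Σ< κ φ +ᴿ φ κ                  ≈⟨ +-cong (Σ-cong′ κ split) refl ⟩
      Σ< κ (λ l → A l +ᴿ B l) +ᴿ φ κ ≈⟨ +-cong (Σ-+ κ A B) refl ⟩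
      (Σ< κ A +ᴿ Σ< κ B) +ᴿ φ κ      ≈⟨ +-assoc _ _ _ ⟩
      Σ< κ A +ᴿ (Σ< κ B +ᴿ φ κ)      ≈⟨ +-cong (sym (first-tile κ m a b)) (sym (G-recurrence a b m)) ⟩
      F z f κ (suc m) a b +ᴿ G (suc m) a b ∎
      where
      φ A B : ℕ → Carrier
      φ l = [ suc l ≤? suc m ]· (w a b m l *ᴿ F z f k (m ∸ l) (a + suc l) b)
      A l = [ suc l ≤? suc m ]· (w a b m l *ᴿ F z f κ (m ∸ l) (a + suc l) b)
      B l = [ suc l ≤? suc m ]· (w a b m l *ᴿ G (m ∸ l) (a + suc l) b)
      -- a first tile shorter than k is followed by a board to which the
      -- induction hypothesis applies
      split : ∀ l → φ l ≈ A l +ᴿ B l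
      split l = trans (bracket-cong (suc l ≤? suc m)
                        (trans (*-cong refl (ih (s≤s (ℕP.m∸n≤m m l)) (a + suc l) b)) (distribˡ _ _ _)))
                      (bracket-+ (suc l ≤? suc m) _ _)

-- The case a = b = 0 of the decomposition; the sum in the statement is
-- G_n[0,0], written with j + 1 for suc j and n + 1 for suc n.
theorem2p4 : ∀ {c ℓ′ : Level} (R : CommutativeRing c ℓ′) →
    let open Weighted R
    in (z : ℕ → Carrier) (f : ℕ → ℕ → ℕ → Carrier) (k : ℕ) → 1 ≤ k →
    (n : ℕ) → 1 ≤ n →
    F z f k n 0 0 ≈
    F z f (k ∸ 1) n 0 0 +ᴿ
    sumRange ((n + 1) ∸ k) (λ j →
    ((z k *ᴿ f k (j + 1) (n ∸ k ∸ j)) *ᴿ F z f (k ∸ 1) j 0 (n ∸ j))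
    *ᴿ F z f k (n ∸ k ∸ j) (k + j) 0)
theorem2p4 R z f (suc κ) (s≤s z≤n) n _ =
  trans (decomposition n 0 0) (+-cong refl (sym (begin
    sumRange ((n + 1) ∸ suc κ) summand ≈⟨ sumRange≈Σ< ((n + 1) ∸ suc κ) summand ⟩
    Σ< ((n + 1) ∸ suc κ) summand      ≈⟨ Σ-bound summand (P.cong (_∸ suc κ) (ℕP.+-comm n 1)) ⟩
    Σ< (suc n ∸ suc κ) summand        ≈⟨ Σ-cong′ (n ∸ κ) (λ j → reflexive (P.cong
                                           (λ x → ((z (suc κ) *ᴿ f (suc κ) x (n ∸ suc κ ∸ j)) *ᴿ F z f κ j 0 (n ∸ j))
                                                  *ᴿ F z f (suc κ) (n ∸ suc κ ∸ j) (suc κ + j) 0)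
                                           (ℕP.+-comm j 1))) ⟩
    G n 0 0 ∎)))
  where
  open Weighted R
  open Sums R
  open Decomposition R z f κ
  open import Relation.Binary.Reasoning.Setoid setoid
  summand : ℕ → Carrier
  summand j = ((z (suc κ) *ᴿ f (suc κ) (j + 1) (n ∸ suc κ ∸ j)) *ᴿ F z f κ j 0 (n ∸ j))
              *ᴿ F z f (suc κ) (n ∸ suc κ ∸ j) (suc κ + j) 0
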